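{- Let $G=([n],E)$ be a graph and let $j\in[n]$ be a simplicial vertex of $G$. Let $H$ be an induced subgraph of $G$ containing $j$. Then no shortest path in $H$ between two vertices of $H$ contains three consecutive vertices $i,j,k$ (in this order along the path) with $j>i$ and $j>k$.
   Context: A vertex $j$ of $G=([n],E)$ is simplicial if $j$ together with its neighbors that are smaller than $j$ forms a clique in $G$. -}

module Defs where

open import Level using (0ℓ)
open import Data.Nat using (ℕ; _≤_)
open import Data.Fin using (Fin; _<_)
open import Data.Fin.Subset using (Subset; _∈_)
open import Data.List using (List; _∷_; []; _++_; head; last; length)
open import Data.List.Relation.Unary.All using (All)
open import Data.List.Relation.Unary.Linked using (Linked)
open import Data.List.Relation.Unary.Unique.Propositional using (Unique)
open import Data.Maybe using (just)
open import Data.Product using (Σ; _×_; ∃₂)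
open import Relation.Binary.PropositionalEquality using (_≡_)
open import Relation.Nullary using (¬_)

-- A (finite simple, undirected) graph G = ([n], E) on the vertex set Fin n
-- (vertices ordered by the natural order of Fin n).
record Graph (n : ℕ) : Set₁ where
  field
    Adj    : Fin n → Fin n → Set
    sym    : ∀ {a b} → Adj a b → Adj b a
    irrefl : ∀ {a} → ¬ Adj a a
open Graph public

Simplicial : ∀ {n} → Graph n → Fin n → Set
Simplicial G j =
  ∀ a b → a < j → b < j → Adj G a j → Adj G b j → ¬ a ≡ b → Adj G a b

-- The induced subgraph H = G[S] of G on a vertex subset S has adjacency
-- Adj G restricted to S.  A path in H from u to v: a nonempty list of
-- distinct vertices of S, starting at u, ending at v, with consecutive
-- vertices adjacent in G (equivalently in G[S], since all lie in S).
record IsPathIn {n : ℕ} (G : Graph n) (S : Subset n) (u v : Fin n)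
                (p : List (Fin n)) : Set where
  field
    start    : head p ≡ just u
    end      : last p ≡ just v
    inS      : All (_∈ S) p
    distinct : Unique p
    adjacent : Linked (Adj G) p

IsShortestPathIn : ∀ {n} → Graph n → Subset n → Fin n → Fin n → List (Fin n) → Set
IsShortestPathIn G S u v p =
  IsPathIn G S u v p × (∀ q → IsPathIn G S u v q → length p ≤ length q)

ConsecutiveTriple : ∀ {n} → List (Fin n) → Fin n → Fin n → Fin n → Set
ConsecutiveTriple p i j k = ∃₂ λ xs ys → p ≡ xs ++ (i ∷ j ∷ k ∷ ys)

{-# OPTIONS --safe #-}
-- If j is an interior vertex of a path with both path-neighbours i, k below j,
-- simpliciality makes i and k adjacent, so deleting j from the path yields a
-- shorter path in the same induced subgraph with the same ends.
module Submission where

open import Defs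
open import Data.Nat using (ℕ; _<_; s≤s)
open import Data.Nat.Properties using (n<1+n; <⇒≱)
open import Data.Fin using (Fin; _>_)
open import Data.Fin.Subset using (Subset; _∈_)
open import Data.List using (List; []; _∷_; _++_; head; last; length)
open import Data.List.Relation.Binary.Sublist.Propositional using (_⊆_; []; _∷_; _∷ʳ_; ⊆-refl)
open import Data.List.Relation.Binary.Sublist.Propositional.Properties using (++⁺; ++⁺ˡ; All-resp-⊆)
open import Data.List.Relation.Unary.All using (_∷_)
open import Data.List.Relation.Unary.AllPairs using (AllPairs; []; _∷_)
open import Data.List.Relation.Unary.Linked as Linked using (Linked; _∷_)
open import Data.Product using (_×_; _,_)
open import Relation.Binary.PropositionalEquality as ≡ using (_≡_; refl)
open import Relation.Nullary using (¬_)

module _ {A : Set} where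

  head-++-∷ : ∀ (xs : List A) {x : A} {ys zs : List A} →
              head (xs ++ x ∷ ys) ≡ head (xs ++ x ∷ zs)
  head-++-∷ []      = refl
  head-++-∷ (_ ∷ _) = refl

  last-++-∷ : ∀ (xs : List A) {y : A} {ys : List A} →
              last (xs ++ y ∷ ys) ≡ last (y ∷ ys)
  last-++-∷ []           = refl
  last-++-∷ (_ ∷ [])     = refl
  last-++-∷ (_ ∷ x ∷ xs) = last-++-∷ (x ∷ xs)

  length-skip : ∀ (xs : List A) {x y : A} {zs : List A} →
                length (xs ++ x ∷ zs) < length (xs ++ x ∷ y ∷ zs)
  length-skip []       = n<1+n _
  length-skip (_ ∷ xs) = s≤s (length-skip xs)

  skip-⊆ : ∀ (xs : List A) {x y : A} {zs : List A} →
           xs ++ x ∷ zs ⊆ xs ++ x ∷ y ∷ zs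
  skip-⊆ xs {y = y} = ++⁺ ⊆-refl (refl ∷ y ∷ʳ ⊆-refl)

  AllPairs-resp-⊆ : ∀ {R : A → A → Set} {xs ys : List A} →
                    xs ⊆ ys → AllPairs R ys → AllPairs R xs
  AllPairs-resp-⊆ []         []           = []
  AllPairs-resp-⊆ (_ ∷ʳ sub) (_ ∷ rys)    = AllPairs-resp-⊆ sub rys
  AllPairs-resp-⊆ (refl ∷ sub) (ry ∷ rys) = All-resp-⊆ sub ry ∷ AllPairs-resp-⊆ sub rys

  AllPairs-skipped : ∀ {R : A → A → Set} (xs : List A) {x y z : A} {ys : List A} →
                     AllPairs R (xs ++ x ∷ y ∷ z ∷ ys) → R x z
  AllPairs-skipped xs rs with AllPairs-resp-⊆ (++⁺ˡ xs ⊆-refl) rs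
  ... | (_ ∷ rxz ∷ _) ∷ _ = rxz

  Linked-++⁻ʳ : ∀ {R : A → A → Set} (xs : List A) {ys : List A} →
                Linked R (xs ++ ys) → Linked R ys
  Linked-++⁻ʳ []       l = l
  Linked-++⁻ʳ (_ ∷ xs) l = Linked-++⁻ʳ xs (Linked.tail l)

  Linked-middle : ∀ {R : A → A → Set} (xs : List A) {x y z : A} {ys : List A} →
                  Linked R (xs ++ x ∷ y ∷ z ∷ ys) → R x y × R y z
  Linked-middle xs l with Linked-++⁻ʳ xs l
  ... | rxy ∷ ryz ∷ _ = rxy , ryz

  Linked-skip : ∀ {R : A → A → Set} (xs : List A) {x y z : A} {ys : List A} →
                R x z → Linked R (xs ++ x ∷ y ∷ z ∷ ys) → Linked R (xs ++ x ∷ z ∷ ys)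
  Linked-skip []           rxz (_ ∷ _ ∷ l) = rxz ∷ l
  Linked-skip (_ ∷ [])     rxz (r ∷ l)     = r ∷ Linked-skip [] rxz l
  Linked-skip (_ ∷ x ∷ xs) rxz (r ∷ l)     = r ∷ Linked-skip (x ∷ xs) rxz l

module _ {n : ℕ} (G : Graph n) (S : Subset n) {u v : Fin n} where

  IsPathIn-skip : ∀ xs {x y z ys} → Adj G x z →
                  IsPathIn G S u v (xs ++ x ∷ y ∷ z ∷ ys) →
                  IsPathIn G S u v (xs ++ x ∷ z ∷ ys)
  IsPathIn-skip xs x~z path = record
    { start    = ≡.trans (head-++-∷ xs) start
    ; end      = ≡.trans (last-++-∷ xs) (≡.trans (≡.sym (last-++-∷ xs)) end)
    ; inS      = All-resp-⊆ (skip-⊆ xs) inS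
    ; distinct = AllPairs-resp-⊆ (skip-⊆ xs) distinct
    ; adjacent = Linked-skip xs x~z adjacent
    }
    where open IsPathIn path

  shortestPath-chordless : ∀ xs {x y z ys} →
                           IsShortestPathIn G S u v (xs ++ x ∷ y ∷ z ∷ ys) →
                           ¬ Adj G x z
  shortestPath-chordless xs (path , shortest) x~z =
    <⇒≱ (length-skip xs) (shortest _ (IsPathIn-skip xs x~z path))

lemma17 : ∀ {n : ℕ} (G : Graph n) (j : Fin n) → Simplicial G j →
          (S : Subset n) → j ∈ S →
          ∀ (u v : Fin n) (p : List (Fin n)) → IsShortestPathIn G S u v p →
          ∀ (i k : Fin n) → ¬ (ConsecutiveTriple p i j k × j > i × j > k)
lemma17 G j simplicial S _ u v _ (path , shortest) i k ((xs , ys , refl) , i<j , k<j) =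
  shortestPath-chordless G S xs (path , shortest) i~k
  where
  open IsPathIn path
  i~k : Adj G i k
  i~k with Linked-middle xs adjacent
  ... | i~j , j~k = simplicial i k i<j k<j i~j (sym G j~k) (AllPairs-skipped xs distinct)
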